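{- Assume one of the following four settings: (i) $\mathfrak{D}'=\mathfrak{D}$ and $R\in\mathfrak{D}$; (ii) $\mathfrak{T}_a\subseteq\mathfrak{D}'\subseteq\mathfrak{D}$ and $R\in\mathfrak{T}_a$; (iii) $\mathfrak{D}'=\mathfrak{P}$ and $R\in\mathfrak{P}$; (iv) $\mathfrak{D}'=\mathfrak{P}^*$ and $R\in\mathfrak{P}^*$. Let $S\in\mathfrak{D}$, and let $\rho$ be an S-scheme from $R$ to $S$ with respect to $\mathfrak{D}'$ such that, for all $G,H\in\mathfrak{D}'$, $\xi\in\mathcal{S}(G,R)$, $\zeta\in\mathcal{S}(H,R)$, $v\in V(G)$, $w\in V(H)$, $$\alpha^R_{G,\xi}(v)=\alpha^R_{H,\zeta}(w)\Rightarrow\alpha^S_{G,\rho_G(\xi)}(v)=\alpha^S_{H,\rho_H(\zeta)}(w).$$ Put $\epsilon:=\alpha^S_{\mathcal{E}(R),\rho_{\mathcal{E}(R)}(\phi_R)}:\mathcal{E}_o(R)\to\mathcal{E}_o(S)$. If $\rho$ is strong, then $\epsilon$ is one-to-one.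
   Context: Digraphs $G=(V(G),A(G))$ have a finite nonempty vertex set, and $A(G)\subseteq V(G)\times V(G)$; loops are allowed. $G^*$ is $G$ with loops removed. $N^{in}_G(v)=\{w\ne v:wv\in A(G)\}$ and $N^{out}_G(v)=\{w\ne v:vw\in A(G)\}$. A homomorphism maps arcs to arcs; it is strict if, in addition, it maps proper arcs to proper arcs. $\mathcal{S}(G,H)$ is the set of strict homomorphisms. Classes of digraphs: - $\mathfrak{D}$ is a representative system of the isomorphism classes of finite digraphs; constructed digraphs are identified with their representatives. - $\mathfrak{T}_a=\{G\in\mathfrak{D}:G^*\text{ has no closed walk}\}$. - $\mathfrak{P}$ is the set of posets (reflexive, antisymmetric, transitive) in $\mathfrak{D}$, and $\mathfrak{P}^*=\{P^*:P\in\mathfrak{P}\}$. An S-scheme from $R$ to $S$ with respect to $\mathfrak{D}'$ is a family of maps $\rho_G:\mathcal{S}(G,R)\to\mathcal{S}(G,S)$, $G\in\mathfrak{D}'$. It is strong if each $\rho_G$ is injective. EV-system of $T\in\{R,S\}$ with respect to $\mathfrak{D}'$: - Vertex set $\mathcal{E}_o(T)=\{(v,D,U):v\in V(T),\ D\subseteq N^{in}_T(v),\ U\subseteq N^{out}_T(v)\}$, with components $\mathfrak{a}_1,\mathfrak{a}_2,\mathfrak{a}_3$. - $\phi_T(\mathfrak{a})=\mathfrak{a}_1$. - $\alpha^T_{G,\xi}(v)=(\xi(v),\xi[N^{in}_G(v)],\xi[N^{out}_G(v)])$ for $G\in\mathfrak{D}'$ and $\xi\in\mathcal{S}(G,T)$.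 - $\mathfrak{a}\mathfrak{b}$ is an arc iff $\mathfrak{a}=\alpha^T_{G,\xi}(v)$ and $\mathfrak{b}=\alpha^T_{G,\xi}(w)$ for some $G\in\mathfrak{D}'$, $\xi\in\mathcal{S}(G,T)$ and $vw\in A(G)$. In each of the settings $\mathcal{E}(R)\in\mathfrak{D}'$ and $\phi_R\in\mathcal{S}(\mathcal{E}(R),R)$, so $\epsilon$ is defined. -}

module Defs where

open import Data.Nat using (ℕ; zero; suc)
open import Data.Fin using (Fin; zero; suc; _≟_)
open import Data.Fin.Subset using (Subset; _⊆_)
open import Data.Bool using (Bool; true; false; _∧_; _∨_; not)
open import Data.Vec using (tabulate)
open import Data.Product using (Σ; _×_; _,_; proj₁; ∃)
open import Relation.Nullary using (¬_)
open import Relation.Nullary.Decidable using (⌊_⌋)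
open import Relation.Binary.PropositionalEquality using (_≡_; _≢_)
open import Function.Bundles using (_⇔_)

-- Finite nonempty digraphs (loops allowed), vertex set Fin (suc size),
-- arc set given by its (decidable) characteristic function.

record Digraph : Set where
  field
    size : ℕ
    arc  : Fin (suc size) → Fin (suc size) → Bool

open Digraph public

V : Digraph → Set
V G = Fin (suc (size G))

Arc : (G : Digraph) → V G → V G → Set
Arc G v w = arc G v w ≡ true

ProperArc : (G : Digraph) → V G → V G → Set
ProperArc G v w = Arc G v w × v ≢ w

Nin : (G : Digraph) → V G → Subset (suc (size G))
Nin G v = tabulate (λ w → arc G w v ∧ not ⌊ w ≟ v ⌋)

Nout : (G : Digraph) → V G → Subset (suc (size G))
Nout G v = tabulate (λ w → arc G v w ∧ not ⌊ w ≟ v ⌋)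

anyFin : {n : ℕ} → (Fin n → Bool) → Bool
anyFin {zero}  f = false
anyFin {suc n} f = f zero ∨ anyFin (λ i → f (suc i))

image : {n k : ℕ} → (Fin n → Fin k) → Subset n → Subset k
image {n} ξ X = tabulate (λ t → anyFin (λ w → Data.Vec.lookup X w ∧ ⌊ ξ w ≟ t ⌋))
  where import Data.Vec

IsStrictHom : (G H : Digraph) → (V G → V H) → Set
IsStrictHom G H ξ =
  ((v w : V G) → Arc G v w → Arc H (ξ v) (ξ w)) ×
  ((v w : V G) → ProperArc G v w → ProperArc H (ξ v) (ξ w))

StrictHom : Digraph → Digraph → Set
StrictHom G H = Σ (V G → V H) (IsStrictHom G H)

data Walk* (G : Digraph) : V G → V G → Set where
  step : ∀ {u w} → ProperArc G u w → Walk* G u w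
  cons : ∀ {u v w} → ProperArc G u v → Walk* G v w → Walk* G u w

InTa : Digraph → Set
InTa G = ∀ v → ¬ Walk* G v v

IsPoset : Digraph → Set
IsPoset G =
  (∀ v → Arc G v v) ×
  (∀ v w → Arc G v w → Arc G w v → v ≡ w) ×
  (∀ u v w → Arc G u v → Arc G v w → Arc G u w)

-- P with all loops added (inverse of _* on loopless digraphs)
addLoops : Digraph → Digraph
addLoops G = record { size = size G ; arc = λ v w → arc G v w ∨ ⌊ v ≟ w ⌋ }

-- membership in 𝔓^* = { P^* : P ∈ 𝔓 }
IsPoset* : Digraph → Set
IsPoset* G = (∀ v → arc G v v ≡ false) × IsPoset (addLoops G)

Triple : Digraph → Set
Triple T = V T × Subset (suc (size T)) × Subset (suc (size T))

InEo : (T : Digraph) → Triple T → Set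
InEo T (v , D , U) = (D ⊆ Nin T v) × (U ⊆ Nout T v)

α : (T G : Digraph) → (V G → V T) → V G → Triple T
α T G ξ v = ξ v , image ξ (Nin G v) , image ξ (Nout G v)

EArc : (D' : Digraph → Set) (T : Digraph) → Triple T → Triple T → Set
EArc D' T a b =
  Σ Digraph λ G → D' G × Σ (StrictHom G T) λ ξ → Σ (V G) λ v → Σ (V G) λ w →
    Arc G v w × α T G (proj₁ ξ) v ≡ a × α T G (proj₁ ξ) w ≡ b

-- A labelled copy of the EV-digraph ℰ(T): a bijective enumeration of
-- ℰ_o(T) by Fin (suc m), together with the arc relation of ℰ(T).
record EVSystem (D' : Digraph → Set) (T : Digraph) : Set₁ where
  field
    m        : ℕ
    enum     : Fin (suc m) → Triple T
    enum-in  : ∀ i → InEo T (enum i)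
    enum-inj : ∀ i j → enum i ≡ enum j → i ≡ j
    enum-sur : ∀ a → InEo T a → ∃ λ i → enum i ≡ a
    earc     : Fin (suc m) → Fin (suc m) → Bool
    earc-spec : ∀ i j → (earc i j ≡ true) ⇔ EArc D' T (enum i) (enum j)

  E : Digraph
  E = record { size = m ; arc = earc }

  φ : V E → V T
  φ i = proj₁ (enum i)

data Setting (D' : Digraph → Set) (R : Digraph) : Set where
  set-i   : (∀ G → D' G) → Setting D' R
  set-ii  : (∀ G → InTa G → D' G) → InTa R → Setting D' R
  set-iii : (∀ G → D' G ⇔ IsPoset G) → IsPoset R → Setting D' R
  set-iv  : (∀ G → D' G ⇔ IsPoset* G) → IsPoset* R → Setting D' R

SScheme : (D' : Digraph → Set) (R S : Digraph) → Set
SScheme D' R S = (G : Digraph) → D' G → StrictHom G R → StrictHom G S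

Strong : (D' : Digraph → Set) (R S : Digraph) → SScheme D' R S → Set
Strong D' R S ρ = ∀ G (g : D' G) (ξ ζ : StrictHom G R) →
  (∀ v → proj₁ (ρ G g ξ) v ≡ proj₁ (ρ G g ζ) v) → ∀ v → proj₁ ξ v ≡ proj₁ ζ v

Compatible : (D' : Digraph → Set) (R S : Digraph) → SScheme D' R S → Set
Compatible D' R S ρ = ∀ G H (g : D' G) (h : D' H)
  (ξ : StrictHom G R) (ζ : StrictHom H R) (v : V G) (w : V H) →
  α R G (proj₁ ξ) v ≡ α R H (proj₁ ζ) w →
  α S G (proj₁ (ρ G g ξ)) v ≡ α S H (proj₁ (ρ H h ζ)) w

module Submission where

-- Every triple a = (x , D , U) of ℰ_o(R) is realised by a star: a centre mapped to x, one in-leaf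
-- mapped to each d ∈ D and one out-leaf mapped to each u ∈ U (plus loops and the chords
-- in-leaf → out-leaf when the setting requires them).  Its α-value at the centre is a, which
-- shows that α_{ℰ(R),φ} is the identity on ℰ_o(R); by compatibility the ρ-image of the star of
-- a vertex k of ℰ(R) then has the α-value ε(k) at its centre.
--
-- Suppose ε(i) = ε(j).  Then every leaf p of the star of i is matched by a leaf q (on the same
-- side) of the star of j with the same ρ-value, and conversely.  The pair star, whose leaves are
-- the matched pairs (p , q), has two strict homomorphisms into R, sending (p , q) to p resp. q and
-- the centre to the centres of i resp. j.  A used leaf's α-value is determined by its value and
-- by the α-value of its centre, so by compatibility ρ maps both homomorphisms to the same map,
-- and strongness makes them equal.  Hence the centres agree and p = q for every matched pair,
-- which gives enum i = enum j.

open import Data.Bool using (Bool; true; false; T; _∧_; _∨_; not)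
open import Data.Bool.Properties using (T-≡; T-∧; T-∨)
open import Data.Empty using (⊥-elim)
open import Data.Fin using (Fin; zero; suc; _≟_; _↑ˡ_; _↑ʳ_; splitAt; join; combine; remQuot)
open import Data.Fin.Properties using (splitAt-↑ˡ; splitAt-↑ʳ; join-splitAt; remQuot-combine)
open import Data.Fin.Subset using (Subset; _∈_; _∉_; _⊆_)
open import Data.Fin.Subset.Properties using (_∈?_; ⊆-antisym)
open import Data.Nat using (ℕ; suc; _+_; _*_; _<_; z<s; s<s)
open import Data.Nat.Properties using (<-trans; <-irrefl; <-asym)
open import Data.Product using (Σ-syntax; ∃-syntax; _×_; _,_; proj₁; proj₂; map₂)
open import Data.Sum using (_⊎_; inj₁; inj₂; [_,_]′)
open import Data.Vec using (tabulate; lookup)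
open import Data.Vec.Properties using (lookup∘tabulate; []=⇒lookup; lookup⇒[]=)
open import Function using (_∘_)
open import Function.Bundles using (_⇔_; mk⇔; Equivalence)
open import Function.Properties.Equivalence using () renaming (trans to ⇔-trans; sym to ⇔-sym)
open import Relation.Nullary using (¬_; Dec; yes; no)
open import Relation.Nullary.Decidable
  using (⌊_⌋; toWitness; fromWitness; toWitnessFalse; fromWitnessFalse)
open import Relation.Binary.PropositionalEquality

open import Defs

open Equivalence using (to; from)

variable
  m n : ℕ
  G H : Digraph

∈⇔T-lookup : {t : Fin n} {X : Subset n} → t ∈ X ⇔ T (lookup X t)
∈⇔T-lookup {t = t} {X} = mk⇔ (from T-≡ ∘ []=⇒lookup) (lookup⇒[]= t X ∘ to T-≡)

∈-tabulate : {t : Fin n} (f : Fin n → Bool) → t ∈ tabulate f ⇔ T (f t)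
∈-tabulate {t = t} f = mk⇔
  (λ t∈ → subst T (lookup∘tabulate f t) (to ∈⇔T-lookup t∈))
  (λ p → from ∈⇔T-lookup (subst T (sym (lookup∘tabulate f t)) p))

T-anyFin : (f : Fin n → Bool) → T (anyFin f) ⇔ (∃[ w ] T (f w))
T-anyFin {n = 0}     f = mk⇔ (λ ()) (λ { (() , _) })
T-anyFin {n = suc n} f = mk⇔ (witness ∘ to T-∨) (from T-∨ ∘ search)
  where
  witness : T (f zero) ⊎ T (anyFin (f ∘ suc)) → ∃[ w ] T (f w)
  witness (inj₁ p) = zero , p
  witness (inj₂ p) = let (w , q) = to (T-anyFin (f ∘ suc)) p in suc w , q
  search : ∃[ w ] T (f w) → T (f zero) ⊎ T (anyFin (f ∘ suc))
  search (zero , p)  = inj₁ p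
  search (suc w , p) = inj₂ (from (T-anyFin (f ∘ suc)) (w , p))

∈-image : {ξ : Fin n → Fin m} {X : Subset n} {t : Fin m} →
  t ∈ image ξ X ⇔ (∃[ w ] w ∈ X × ξ w ≡ t)
∈-image {ξ = ξ} {X} {t} = mk⇔ preimage λ (w , w∈ , e) →
  from (∈-tabulate _) (from (T-anyFin _) (w , from T-∧ (to ∈⇔T-lookup w∈ , fromWitness e)))
  where
  preimage : t ∈ image ξ X → ∃[ w ] w ∈ X × ξ w ≡ t
  preimage t∈ = let (w , p) = to (T-anyFin _) (to (∈-tabulate _) t∈)
                    (w∈ , e) = to T-∧ p
                in w , from ∈⇔T-lookup w∈ , toWitness e

data Dir : Set where
  In Out : Dir

opp : Dir → Dir
opp In  = Out
opp Out = In

Nbr : Dir → (G : Digraph) → V G → V G → Set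
Nbr In  G v u = ProperArc G u v
Nbr Out G v u = ProperArc G v u

N : Dir → (G : Digraph) → V G → Subset (suc (size G))
N In  = Nin
N Out = Nout

∈-N : ∀ δ G {v u : V G} → u ∈ N δ G v ⇔ Nbr δ G v u
∈-N In  G {v} = mk⇔
  (λ u∈ → let (a , u≢v) = to T-∧ (to (∈-tabulate adjacent) u∈) in to T-≡ a , toWitnessFalse u≢v)
  (λ (a , u≢v) → from (∈-tabulate adjacent) (from T-∧ (from T-≡ a , fromWitnessFalse u≢v)))
  where
  adjacent : V G → Bool
  adjacent w = arc G w v ∧ not ⌊ w ≟ v ⌋
∈-N Out G {v} = mk⇔
  (λ u∈ → let (a , u≢v) = to T-∧ (to (∈-tabulate adjacent) u∈)
          in to T-≡ a , ≢-sym (toWitnessFalse u≢v))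
  (λ (a , v≢u) → from (∈-tabulate adjacent) (from T-∧ (from T-≡ a , fromWitnessFalse (≢-sym v≢u))))
  where
  adjacent : V G → Bool
  adjacent w = arc G v w ∧ not ⌊ w ≟ v ⌋

Image : Dir → (G : Digraph) → (V G → Fin n) → V G → Fin n → Set
Image δ G f v t = ∃[ u ] Nbr δ G v u × f u ≡ t

strict-Nbr : ∀ δ {ξ : V G → V H} {v u} → IsStrictHom G H ξ → Nbr δ G v u → Nbr δ H (ξ v) (ξ u)
strict-Nbr In  (_ , proper) = proper _ _
strict-Nbr Out (_ , proper) = proper _ _

component : Dir → Fin m × Subset m × Subset m → Subset m
component In  (_ , D , _) = D
component Out (_ , _ , U) = U

triple-≡ : {a b : Fin m × Subset m × Subset m} →
  proj₁ a ≡ proj₁ b → (∀ δ → component δ a ≡ component δ b) → a ≡ b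
triple-≡ {a = _ , _ , _} {_ , _ , _} x≡ c≡ = cong₂ _,_ x≡ (cong₂ _,_ (c≡ In) (c≡ Out))

∈-component-α : ∀ δ H G (f : V G → V H) v {t} → t ∈ component δ (α H G f v) ⇔ Image δ G f v t
∈-component-α δ H G f v = mk⇔
  (λ t∈ → let (u , u∈ , e) = to (∈-image {ξ = f}) (subst (_ ∈_) (component-α δ) t∈)
          in u , to (∈-N δ G) u∈ , e)
  (λ (u , nb , e) → subst (_ ∈_) (sym (component-α δ))
                      (from (∈-image {ξ = f}) (u , from (∈-N δ G) nb , e)))
  where
  component-α : ∀ δ → component δ (α H G f v) ≡ image f (N δ G v)
  component-α In  = refl
  component-α Out = refl

InEo-intro : {a : Triple H} → (∀ δ {t} → t ∈ component δ a → Nbr δ H (proj₁ a) t) → InEo H a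
InEo-intro {H} {a = _ , _ , _} nbr = from (∈-N In H) ∘ nbr In , from (∈-N Out H) ∘ nbr Out

InEo⇒Nbr : {a : Triple H} → InEo H a → ∀ δ {t} → t ∈ component δ a → Nbr δ H (proj₁ a) t
InEo⇒Nbr {H} {a = _ , _ , _} (D⊆ , _) In  = to (∈-N In H) ∘ D⊆
InEo⇒Nbr {H} {a = _ , _ , _} (_ , U⊆) Out = to (∈-N Out H) ∘ U⊆

α-InEo : ∀ H G {ξ : V G → V H} v → IsStrictHom G H ξ → InEo H (α H G ξ v)
α-InEo H G {ξ} v strict = InEo-intro λ δ t∈ →
  let (u , nb , e) = to (∈-component-α δ H G ξ v) t∈
  in subst (Nbr δ H (ξ v)) e (strict-Nbr δ strict nb)

α-≡-triple : ∀ H G (f : V G → V H) v {a : Triple H} → f v ≡ proj₁ a →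
  (∀ δ t → Image δ G f v t ⇔ t ∈ component δ a) → α H G f v ≡ a
α-≡-triple H G f v e img = triple-≡ e λ δ →
  ⊆-antisym (to (img δ _) ∘ to (∈-component-α δ H G f v))
            (from (∈-component-α δ H G f v) ∘ from (img δ _))

α-≡ : ∀ H G (f : V G → V H) v G′ (g : V G′ → V H) w → f v ≡ g w →
  (∀ δ t → Image δ G f v t ⇔ Image δ G′ g w t) → α H G f v ≡ α H G′ g w
α-≡ H G f v G′ g w e img =
  α-≡-triple H G f v e λ δ t → ⇔-trans (img δ t) (⇔-sym (∈-component-α δ H G′ g w))

α-≡⇒Image : ∀ H G (f : V G → V H) v G′ (g : V G′ → V H) w →
  α H G f v ≡ α H G′ g w → ∀ {δ t} → Image δ G f v t → Image δ G′ g w t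
α-≡⇒Image H G f v G′ g w e {δ} =
  to (∈-component-α δ H G′ g w) ∘ subst (_ ∈_) (cong (component δ) e)
  ∘ from (∈-component-α δ H G f v)

ValueOrImage : Bool → Dir → (G : Digraph) → (V G → Fin n) → V G → Fin n → Set
ValueOrImage b δ G f v t = f v ≡ t ⊎ (T b × Image δ G f v t)

α-≡⇒ValueOrImage : ∀ H G (f : V G → V H) v G′ (g : V G′ → V H) w →
  α H G f v ≡ α H G′ g w → ∀ {b δ t} → ValueOrImage b δ G f v t → ValueOrImage b δ G′ g w t
α-≡⇒ValueOrImage H G f v G′ g w e (inj₁ fv≡t)      = inj₁ (trans (sym (cong proj₁ e)) fv≡t)
α-≡⇒ValueOrImage H G f v G′ g w e (inj₂ (b , img)) = inj₂ (b , α-≡⇒Image H G f v G′ g w e img)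

α-isolated-≡ : ∀ H G (f g : V G → V H) v → (∀ δ u → ¬ Nbr δ G v u) → f v ≡ g v →
  α H G f v ≡ α H G g v
α-isolated-≡ H G f g v isolated e = α-≡ H G f v G g v e λ δ t →
  mk⇔ (λ (u , nb , _) → ⊥-elim (isolated δ u nb)) (λ (u , nb , _) → ⊥-elim (isolated δ u nb))

Ranked : (G : Digraph) → (V G → ℕ) → Set
Ranked G rank = ∀ {v w} → ProperArc G v w → rank v < rank w

ProperTransitive : Digraph → Set
ProperTransitive G = ∀ {u v w} → ProperArc G u v → ProperArc G v w → ProperArc G u w

ranked⇒InTa : {rank : V G → ℕ} → Ranked G rank → InTa G
ranked⇒InTa {G} {rank} ranked v walk = <-irrefl refl (climb walk)
  where
  climb : ∀ {u w} → Walk* G u w → rank u < rank w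
  climb (step p)   = ranked p
  climb (cons p q) = <-trans (ranked p) (climb q)

ranked⇒IsPoset : {rank : V G → ℕ} → Ranked G rank → ProperTransitive G → (∀ v → Arc G v v) →
  IsPoset G
ranked⇒IsPoset {G} ranked properTransitive reflexive = reflexive , antisymmetric , transitive
  where
  antisymmetric : ∀ v w → Arc G v w → Arc G w v → v ≡ w
  antisymmetric v w vw wv with v ≟ w
  ... | yes v≡w = v≡w
  ... | no v≢w  = ⊥-elim (<-asym (ranked (vw , v≢w)) (ranked (wv , ≢-sym v≢w)))
  transitive : ∀ u v w → Arc G u v → Arc G v w → Arc G u w
  transitive u v w uv vw with u ≟ v | v ≟ w
  ... | yes refl | _        = vw
  ... | no _     | yes refl = uv
  ... | no u≢v   | no v≢w   = proj₁ (properTransitive (uv , u≢v) (vw , v≢w))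

IsPoset⇒ProperTransitive : IsPoset G → ProperTransitive G
IsPoset⇒ProperTransitive (_ , antisymmetric , transitive) {u} {v} {w} (uv , u≢v) (vw , _) =
  transitive u v w uv vw , λ { refl → u≢v (antisymmetric u v uv vw) }

addLoops-properArc : ∀ G {v w} → ProperArc (addLoops G) v w ⇔ ProperArc G v w
addLoops-properArc G = mk⇔
  (λ (a , v≢w) → [ to T-≡ , ⊥-elim ∘ v≢w ∘ toWitness ]′ (to T-∨ (from T-≡ a)) , v≢w)
  (λ (a , v≢w) → to T-≡ (from T-∨ (inj₁ (from T-≡ a))) , v≢w)

addLoops-reflexive : ∀ G v → Arc (addLoops G) v v
addLoops-reflexive G v = to T-≡ (from (T-∨ {arc G v v}) (inj₂ (fromWitness refl)))

addLoops-ranked : {rank : V G → ℕ} → Ranked G rank → Ranked (addLoops G) rank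
addLoops-ranked {G} ranked = ranked ∘ to (addLoops-properArc G)

addLoops-ProperTransitive : ∀ G → ProperTransitive G ⇔ ProperTransitive (addLoops G)
addLoops-ProperTransitive G = mk⇔
  (λ transitive {_} {_} {_} uv vw → from proper (transitive (to proper uv) (to proper vw)))
  (λ transitive {_} {_} {_} uv vw → to proper (transitive (from proper uv) (from proper vw)))
  where
  proper : ∀ {v w} → ProperArc (addLoops G) v w ⇔ ProperArc G v w
  proper = addLoops-properArc G

data Node (K : ℕ) : Set where
  centre : Node K
  leaf   : Dir → Fin K → Node K

-- Loops and chords are switched on exactly when the setting needs them for the star to lie in 𝔇′:
-- both make it a poset (iii), chords alone a loopless poset (iv).
module Star (K : ℕ) (used : Dir → Subset K) (loops transitive : Bool) where

  enc : Node K → Fin (suc (K + K))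
  enc centre       = zero
  enc (leaf In a)  = suc (a ↑ˡ K)
  enc (leaf Out b) = suc (K ↑ʳ b)

  dec : Fin (suc (K + K)) → Node K
  dec zero    = centre
  dec (suc t) = [ leaf In , leaf Out ]′ (splitAt K t)

  dec-enc : ∀ k → dec (enc k) ≡ k
  dec-enc centre       = refl
  dec-enc (leaf In a)  = cong [ leaf In , leaf Out ]′ (splitAt-↑ˡ K a K)
  dec-enc (leaf Out b) = cong [ leaf In , leaf Out ]′ (splitAt-↑ʳ K K b)

  enc-dec : ∀ v → enc (dec v) ≡ v
  enc-dec zero    = refl
  enc-dec (suc t) = trans (enc-leaf (splitAt K t)) (cong suc (join-splitAt K K t))
    where
    enc-leaf : ∀ x → enc ([ leaf In , leaf Out ]′ x) ≡ suc (join K K x)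
    enc-leaf (inj₁ _) = refl
    enc-leaf (inj₂ _) = refl

  data Arrow : Node K → Node K → Set where
    spoke-in  : ∀ {a} → a ∈ used In → Arrow (leaf In a) centre
    spoke-out : ∀ {b} → b ∈ used Out → Arrow centre (leaf Out b)
    chord     : ∀ {a b} → T transitive → a ∈ used In → b ∈ used Out →
                Arrow (leaf In a) (leaf Out b)

  arrow? : Node K → Node K → Bool
  arrow? (leaf In a) centre       = lookup (used In) a
  arrow? centre (leaf Out b)      = lookup (used Out) b
  arrow? (leaf In a) (leaf Out b) = transitive ∧ (lookup (used In) a ∧ lookup (used Out) b)
  arrow? _ _                      = false

  T-arrow? : ∀ k k′ → T (arrow? k k′) ⇔ Arrow k k′
  T-arrow? (leaf In a) centre        =
    mk⇔ (spoke-in ∘ from ∈⇔T-lookup) λ { (spoke-in a∈) → to ∈⇔T-lookup a∈ }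
  T-arrow? centre (leaf Out b)       =
    mk⇔ (spoke-out ∘ from ∈⇔T-lookup) λ { (spoke-out b∈) → to ∈⇔T-lookup b∈ }
  T-arrow? (leaf In a) (leaf Out b)  = mk⇔
    (λ p → let (tr , q) = to T-∧ p ; (a∈ , b∈) = to T-∧ q
           in chord tr (from ∈⇔T-lookup a∈) (from ∈⇔T-lookup b∈))
    (λ { (chord tr a∈ b∈) →
           from T-∧ (tr , from T-∧ (to ∈⇔T-lookup a∈ , to ∈⇔T-lookup b∈)) })
  T-arrow? centre centre             = mk⇔ (λ ()) (λ ())
  T-arrow? centre (leaf In _)        = mk⇔ (λ ()) (λ ())
  T-arrow? (leaf In _) (leaf In _)   = mk⇔ (λ ()) (λ ())
  T-arrow? (leaf Out _) centre       = mk⇔ (λ ()) (λ ())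
  T-arrow? (leaf Out _) (leaf In _)  = mk⇔ (λ ()) (λ ())
  T-arrow? (leaf Out _) (leaf Out _) = mk⇔ (λ ()) (λ ())

  Arrow-irrefl : ∀ {k} → ¬ Arrow k k
  Arrow-irrefl ()

  digraph : Digraph
  digraph = record { size = K + K ; arc = λ v w → (loops ∧ ⌊ v ≟ w ⌋) ∨ arrow? (dec v) (dec w) }

  arc-cases : ∀ {v w} → Arc digraph v w → (T loops × v ≡ w) ⊎ Arrow (dec v) (dec w)
  arc-cases {v} {w} a with to T-∨ (from T-≡ a)
  ... | inj₁ p = let (l , e) = to T-∧ p in inj₁ (l , toWitness e)
  ... | inj₂ p = inj₂ (to (T-arrow? (dec v) (dec w)) p)

  properArc⇔Arrow : ∀ {v w} → ProperArc digraph v w ⇔ Arrow (dec v) (dec w)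
  properArc⇔Arrow {v} {w} = mk⇔
    (λ (a , v≢w) → [ ⊥-elim ∘ v≢w ∘ proj₂ , (λ ar → ar) ]′ (arc-cases a))
    (λ ar → to T-≡ (from (T-∨ {loops ∧ ⌊ v ≟ w ⌋}) (inj₂ (from (T-arrow? (dec v) (dec w)) ar)))
          , λ { refl → Arrow-irrefl ar })

  reflexive : T loops → ∀ v → Arc digraph v v
  reflexive l v = to T-≡ (from T-∨ (inj₁ (from T-∧ (l , fromWitness refl))))

  irreflexive : loops ≡ false → ∀ v → arc digraph v v ≡ false
  irreflexive l v rewrite l = arrow?-irrefl (dec v)
    where
    arrow?-irrefl : ∀ k → arrow? k k ≡ false
    arrow?-irrefl centre       = refl
    arrow?-irrefl (leaf In _)  = refl
    arrow?-irrefl (leaf Out _) = refl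

  height : Node K → ℕ
  height (leaf In _)  = 0
  height centre       = 1
  height (leaf Out _) = 2

  Arrow-height : ∀ {k k′} → Arrow k k′ → height k < height k′
  Arrow-height (spoke-in _)  = z<s
  Arrow-height (spoke-out _) = s<s z<s
  Arrow-height (chord _ _ _) = z<s

  ranked : Ranked digraph (height ∘ dec)
  ranked = Arrow-height ∘ to properArc⇔Arrow

  properTransitive : T transitive → ProperTransitive digraph
  properTransitive tr uv vw =
    from properArc⇔Arrow (compose (to properArc⇔Arrow uv) (to properArc⇔Arrow vw))
    where
    compose : ∀ {k₁ k₂ k₃} → Arrow k₁ k₂ → Arrow k₂ k₃ → Arrow k₁ k₃
    compose (spoke-in a∈) (spoke-out b∈) = chord tr a∈ b∈

  NbrN : Dir → Node K → Node K → Set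
  NbrN In  k k′ = Arrow k′ k
  NbrN Out k k′ = Arrow k k′

  spoke : ∀ δ {a} → a ∈ used δ → NbrN δ centre (leaf δ a)
  spoke In  = spoke-in
  spoke Out = spoke-out

  Nbr⇔NbrN : ∀ δ {v u} → Nbr δ digraph v u ⇔ NbrN δ (dec v) (dec u)
  Nbr⇔NbrN In  = properArc⇔Arrow
  Nbr⇔NbrN Out = properArc⇔Arrow

  Nbr-enc : ∀ δ {k k′} → Nbr δ digraph (enc k) (enc k′) ⇔ NbrN δ k k′
  Nbr-enc δ {k} {k′} =
    subst₂ (λ x y → Nbr δ digraph (enc k) (enc k′) ⇔ NbrN δ x y) (dec-enc k) (dec-enc k′)
           (Nbr⇔NbrN δ)

  unused-NbrN : ∀ {δ a k} → a ∉ used δ → ∀ δ′ → ¬ NbrN δ′ (leaf δ a) k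
  unused-NbrN a∉ Out (spoke-in a∈)  = a∉ a∈
  unused-NbrN a∉ Out (chord _ a∈ _) = a∉ a∈
  unused-NbrN a∉ In  (spoke-out a∈) = a∉ a∈
  unused-NbrN a∉ In  (chord _ _ a∈) = a∉ a∈

  unused-isolated : ∀ {δ a} → a ∉ used δ → ∀ δ′ u → ¬ Nbr δ′ digraph (enc (leaf δ a)) u
  unused-isolated {δ} {a} a∉ δ′ u =
    unused-NbrN a∉ δ′ ∘ subst (λ x → NbrN δ′ x (dec u)) (dec-enc (leaf δ a)) ∘ to (Nbr⇔NbrN δ′)

  leaf-NbrN : ∀ δ δ′ {a k} → a ∈ used δ →
    NbrN δ′ (leaf δ a) k ⇔ (δ′ ≡ opp δ × (k ≡ centre ⊎ (T transitive × NbrN δ′ centre k)))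
  leaf-NbrN In  In  _  = mk⇔ (λ ()) (λ { (() , _) })
  leaf-NbrN In  Out a∈ = mk⇔
    (λ { (spoke-in _)    → refl , inj₁ refl
       ; (chord tr _ b∈) → refl , inj₂ (tr , spoke-out b∈) })
    (λ { (refl , inj₁ refl)                → spoke-in a∈
       ; (refl , inj₂ (tr , spoke-out b∈)) → chord tr a∈ b∈ })
  leaf-NbrN Out In  b∈ = mk⇔
    (λ { (spoke-out _)   → refl , inj₁ refl
       ; (chord tr a∈ _) → refl , inj₂ (tr , spoke-in a∈) })
    (λ { (refl , inj₁ refl)               → spoke-out b∈
       ; (refl , inj₂ (tr , spoke-in a∈)) → chord tr a∈ b∈ })
  leaf-NbrN Out Out _  = mk⇔ (λ ()) (λ { (() , _) })

  module _ (f : V digraph → Fin m) where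

    Image-enc : ∀ δ {k t} →
      Image δ digraph f (enc k) t ⇔ (∃[ k′ ] NbrN δ k k′ × f (enc k′) ≡ t)
    Image-enc δ {k} = mk⇔
      (λ (u , nb , e) → dec u , subst (λ x → NbrN δ x (dec u)) (dec-enc k) (to (Nbr⇔NbrN δ) nb)
                              , trans (cong f (enc-dec u)) e)
      (λ (k′ , nb , e) → enc k′ , from (Nbr-enc δ) nb , e)

    Image-centre : ∀ δ {t} →
      Image δ digraph f (enc centre) t ⇔ (∃[ a ] a ∈ used δ × f (enc (leaf δ a)) ≡ t)
    Image-centre δ {t} = ⇔-trans (Image-enc δ)
      (mk⇔ (λ (_ , nb , e) → spoke⁻¹ δ nb e) (λ (a , a∈ , e) → leaf δ a , spoke δ a∈ , e))
      where
      spoke⁻¹ : ∀ δ {k} → NbrN δ centre k → f (enc k) ≡ t →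
        ∃[ a ] a ∈ used δ × f (enc (leaf δ a)) ≡ t
      spoke⁻¹ In  (spoke-in a∈)  e = _ , a∈ , e
      spoke⁻¹ Out (spoke-out b∈) e = _ , b∈ , e

    Image-leaf : ∀ δ δ′ {a t} → a ∈ used δ → Image δ′ digraph f (enc (leaf δ a)) t ⇔
      (δ′ ≡ opp δ × ValueOrImage transitive δ′ digraph f (enc centre) t)
    Image-leaf δ δ′ {a} {t} a∈ =
      mk⇔ (leaf→centre ∘ to (Image-enc δ′)) (from (Image-enc δ′) ∘ centre→leaf)
      where
      ViaCentre : Set
      ViaCentre = δ′ ≡ opp δ × ValueOrImage transitive δ′ digraph f (enc centre) t
      leaf→centre : (∃[ k ] NbrN δ′ (leaf δ a) k × f (enc k) ≡ t) → ViaCentre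
      leaf→centre (k , nb , e) with to (leaf-NbrN δ δ′ a∈) nb
      ... | p , inj₁ refl       = p , inj₁ e
      ... | p , inj₂ (tr , nb′) = p , inj₂ (tr , from (Image-enc δ′) (k , nb′ , e))
      centre→leaf : ViaCentre → ∃[ k ] NbrN δ′ (leaf δ a) k × f (enc k) ≡ t
      centre→leaf (p , inj₁ e)          = centre , from (leaf-NbrN δ δ′ a∈) (p , inj₁ refl) , e
      centre→leaf (p , inj₂ (tr , img)) =
        let (k , nb , e) = to (Image-enc δ′) img
        in k , from (leaf-NbrN δ δ′ a∈) (p , inj₂ (tr , nb)) , e

  -- Unused leaves go to the vertex zero, which is harmless since they are isolated.
  module Hom (H : Digraph) (c : V H) (label : Dir → Fin K → V H) where

    nodeMap : Node K → V H
    nodeMap centre = c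
    nodeMap (leaf δ a) with a ∈? used δ
    ... | yes _ = label δ a
    ... | no _  = zero

    hom : V digraph → V H
    hom = nodeMap ∘ dec

    hom-enc : ∀ k → hom (enc k) ≡ nodeMap k
    hom-enc k = cong nodeMap (dec-enc k)

    nodeMap-used : ∀ {δ a} → a ∈ used δ → nodeMap (leaf δ a) ≡ label δ a
    nodeMap-used {δ} {a} a∈ with a ∈? used δ
    ... | yes _ = refl
    ... | no a∉ = ⊥-elim (a∉ a∈)

    nodeMap-unused : ∀ {δ a} → a ∉ used δ → nodeMap (leaf δ a) ≡ zero
    nodeMap-unused {δ} {a} a∉ with a ∈? used δ
    ... | yes a∈ = ⊥-elim (a∉ a∈)
    ... | no _   = refl

    hom-leaf : ∀ {δ a} → a ∈ used δ → hom (enc (leaf δ a)) ≡ label δ a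
    hom-leaf {δ} {a} a∈ = trans (hom-enc (leaf δ a)) (nodeMap-used a∈)

    hom-unused : ∀ {δ a} → a ∉ used δ → hom (enc (leaf δ a)) ≡ zero
    hom-unused {δ} {a} a∉ = trans (hom-enc (leaf δ a)) (nodeMap-unused a∉)

    hom-strict : (T loops → ∀ r → Arc H r r) →
      (∀ δ {a} → a ∈ used δ → Nbr δ H c (label δ a)) →
      (T transitive → ∀ {a b} → a ∈ used In → b ∈ used Out →
        ProperArc H (label In a) (label Out b)) →
      IsStrictHom digraph H hom
    hom-strict loops-H spokes-H chords-H = arcs , λ v w → arrow-hom ∘ to properArc⇔Arrow
      where
      arrow-hom : ∀ {k k′} → Arrow k k′ → ProperArc H (nodeMap k) (nodeMap k′)
      arrow-hom (spoke-in a∈)    = subst (λ x → ProperArc H x c) (sym (nodeMap-used a∈)) (spokes-H In a∈)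
      arrow-hom (spoke-out b∈)   = subst (ProperArc H c) (sym (nodeMap-used b∈)) (spokes-H Out b∈)
      arrow-hom (chord tr a∈ b∈) =
        subst₂ (ProperArc H) (sym (nodeMap-used a∈)) (sym (nodeMap-used b∈)) (chords-H tr a∈ b∈)
      arcs : ∀ v w → Arc digraph v w → Arc H (hom v) (hom w)
      arcs v w a with arc-cases a
      ... | inj₁ (l , refl) = loops-H l (hom v)
      ... | inj₂ ar         = proj₁ (arrow-hom ar)

    α-centre : {a : Triple H} → c ≡ proj₁ a →
      (∀ δ {b} → b ∈ used δ → label δ b ∈ component δ a) →
      (∀ δ {t} → t ∈ component δ a → ∃[ b ] b ∈ used δ × label δ b ≡ t) →
      α H digraph hom (enc centre) ≡ a
    α-centre {a} c≡ sound complete =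
      α-≡-triple H digraph hom (enc centre) (trans (hom-enc centre) c≡) λ δ t → mk⇔
        (λ img → let (b , b∈ , e) = to (Image-centre hom δ) img
                 in subst (_∈ component δ a) (trans (sym (hom-leaf b∈)) e) (sound δ b∈))
        (λ t∈ → let (b , b∈ , e) = complete δ t∈
                in from (Image-centre hom δ) (b , b∈ , trans (hom-leaf b∈) e))

module TwoStars (loops transitive : Bool) {K₁ K₂ : ℕ}
  (used₁ : Dir → Subset K₁) (used₂ : Dir → Subset K₂) where

  module S₁ = Star K₁ used₁ loops transitive
  module S₂ = Star K₂ used₂ loops transitive

  module _ (H : Digraph) (f₁ : V S₁.digraph → V H) (f₂ : V S₂.digraph → V H)
    (centres : α H S₁.digraph f₁ (S₁.enc centre) ≡ α H S₂.digraph f₂ (S₂.enc centre)) where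

    leaf-match : ∀ {δ a₁} → a₁ ∈ used₁ δ →
      ∃[ a₂ ] a₂ ∈ used₂ δ × f₂ (S₂.enc (leaf δ a₂)) ≡ f₁ (S₁.enc (leaf δ a₁))
    leaf-match {δ} a₁∈ = to (S₂.Image-centre f₂ δ)
      (α-≡⇒Image H S₁.digraph f₁ _ S₂.digraph f₂ _ centres
        (from (S₁.Image-centre f₁ δ) (_ , a₁∈ , refl)))

    -- The neighbours of a used leaf are the centre and, through the chords, the centre's
    -- neighbours on the other side.
    leaf-α-≡ : ∀ {δ a₁ a₂} → a₁ ∈ used₁ δ → a₂ ∈ used₂ δ →
      f₁ (S₁.enc (leaf δ a₁)) ≡ f₂ (S₂.enc (leaf δ a₂)) →
      α H S₁.digraph f₁ (S₁.enc (leaf δ a₁)) ≡ α H S₂.digraph f₂ (S₂.enc (leaf δ a₂))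
    leaf-α-≡ {δ} a₁∈ a₂∈ e = α-≡ H S₁.digraph f₁ _ S₂.digraph f₂ _ e λ δ′ t →
      ⇔-trans (S₁.Image-leaf f₁ δ δ′ a₁∈) (⇔-trans
        (mk⇔ (map₂ (α-≡⇒ValueOrImage H S₁.digraph f₁ _ S₂.digraph f₂ _ centres))
             (map₂ (α-≡⇒ValueOrImage H S₂.digraph f₂ _ S₁.digraph f₁ _ (sym centres))))
        (⇔-sym (S₂.Image-leaf f₂ δ δ′ a₂∈)))

module _ {D' : Digraph → Set} {R : Digraph} where

  loopsOf : Setting D' R → Bool
  loopsOf (set-iii _ _) = true
  loopsOf _             = false

  transitiveOf : Setting D' R → Bool
  transitiveOf (set-iii _ _) = true
  transitiveOf (set-iv _ _)  = true
  transitiveOf _             = false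

  loops-R : (s : Setting D' R) → T (loopsOf s) → ∀ r → Arc R r r
  loops-R (set-iii _ (reflexive , _)) _ = reflexive

  transitive-R : (s : Setting D' R) → T (transitiveOf s) → ProperTransitive R
  transitive-R (set-iii _ poset)      _ = IsPoset⇒ProperTransitive poset
  transitive-R (set-iv _ (_ , poset)) _ =
    from (addLoops-ProperTransitive R) (IsPoset⇒ProperTransitive poset)

  star∈D' : (s : Setting D' R) (K : ℕ) (used : Dir → Subset K) →
    D' (Star.digraph K used (loopsOf s) (transitiveOf s))
  star∈D' (set-i all)    K used = all _
  star∈D' (set-ii ⊇Ta _) K used = ⊇Ta _ (ranked⇒InTa ranked)
    where open Star K used false false
  star∈D' (set-iii ≡P _) K used = from (≡P _) (ranked⇒IsPoset ranked (properTransitive _) (reflexive _))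
    where open Star K used true true
  star∈D' (set-iv ≡P* _) K used = from (≡P* _)
    ( irreflexive refl
    , ranked⇒IsPoset (addLoops-ranked ranked) (to (addLoops-ProperTransitive digraph) (properTransitive _))
                     (addLoops-reflexive digraph))
    where open Star K used false true

  module StarIn (s : Setting D' R) {K : ℕ} (used : Dir → Subset K) where

    open Star K used (loopsOf s) (transitiveOf s) public

    ∈D' : D' digraph
    ∈D' = star∈D' s K used

    hom-strict-at : {a : Triple R} → InEo R a → (label : Dir → Fin K → V R) →
      (∀ δ {b} → b ∈ used δ → label δ b ∈ component δ a) →
      IsStrictHom digraph R (Hom.hom R (proj₁ a) label)
    hom-strict-at {a} a∈ label sound = Hom.hom-strict R _ label (loops-R s) (λ δ → nbr δ ∘ sound δ)
      (λ tr a∈′ b∈ → transitive-R s tr (nbr In (sound In a∈′)) (nbr Out (sound Out b∈)))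
      where
      nbr : ∀ δ {t} → t ∈ component δ a → Nbr δ R (proj₁ a) t
      nbr = InEo⇒Nbr {R} a∈

module EV {D' : Digraph → Set} {R : Digraph} (s : Setting D' R) (𝓔 : EVSystem D' R) where

  open EVSystem 𝓔

  index : ∀ G → StrictHom G R → V G → V E
  index G (ξ , strict) v = proj₁ (enum-sur (α R G ξ v) (α-InEo R G v strict))

  enum-index : ∀ G (ξ : StrictHom G R) v → enum (index G ξ v) ≡ α R G (proj₁ ξ) v
  enum-index G (ξ , strict) v = proj₂ (enum-sur (α R G ξ v) (α-InEo R G v strict))

  properArc-realised : ∀ G → D' G → (ξ : StrictHom G R) → ∀ {v w k l} → ProperArc G v w →
    enum k ≡ α R G (proj₁ ξ) v → enum l ≡ α R G (proj₁ ξ) w → ProperArc E k l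
  properArc-realised G G∈ (ξ , strict) {v} {w} {k} {l} (vw , v≢w) k≡ l≡ =
    from (earc-spec k l) (G , G∈ , (ξ , strict) , v , w , vw , sym k≡ , sym l≡) ,
    λ k≡l → proj₂ (proj₂ strict v w (vw , v≢w))
      (trans (sym (cong proj₁ k≡)) (trans (cong φ k≡l) (cong proj₁ l≡)))

  Nbr-realised : ∀ δ G → D' G → (ξ : StrictHom G R) → ∀ {v u k l} → Nbr δ G v u →
    enum k ≡ α R G (proj₁ ξ) v → enum l ≡ α R G (proj₁ ξ) u → Nbr δ E k l
  Nbr-realised In  G G∈ ξ nb k≡ l≡ = properArc-realised G G∈ ξ nb l≡ k≡
  Nbr-realised Out G G∈ ξ nb k≡ l≡ = properArc-realised G G∈ ξ nb k≡ l≡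

  properArc-witness : ∀ {k l} → ProperArc E k l →
    Σ[ G ∈ Digraph ] Σ[ ξ ∈ (V G → V R) ] Σ[ v ∈ V G ] Σ[ w ∈ V G ]
      ProperArc G v w × α R G ξ v ≡ enum k × α R G ξ w ≡ enum l
  properArc-witness {k} {l} (kl , k≢l) =
    let (G , _ , (ξ , _) , v , w , vw , v≡ , w≡) = to (earc-spec k l) kl
        v≢w : v ≢ w
        v≢w v≡w = k≢l (enum-inj k l (trans (sym v≡) (trans (cong (α R G ξ) v≡w) w≡)))
    in G , ξ , v , w , (vw , v≢w) , v≡ , w≡

  Nbr-witness : ∀ δ {k l} → Nbr δ E k l →
    Σ[ G ∈ Digraph ] Σ[ ξ ∈ (V G → V R) ] Σ[ v ∈ V G ] Σ[ u ∈ V G ]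
      Nbr δ G v u × α R G ξ v ≡ enum k × α R G ξ u ≡ enum l
  Nbr-witness In nb =
    let (G , ξ , u , v , uv , u≡ , v≡) = properArc-witness nb in G , ξ , v , u , uv , v≡ , u≡
  Nbr-witness Out = properArc-witness

  Nbr⇒∈component : ∀ δ {k l} → Nbr δ E k l → φ l ∈ component δ (enum k)
  Nbr⇒∈component δ nb =
    let (G , ξ , v , u , vu , v≡ , u≡) = Nbr-witness δ nb
    in subst₂ (λ t a → t ∈ component δ a) (cong proj₁ u≡) v≡
         (from (∈-component-α δ R G ξ v) (u , vu , refl))

  module Realiser (k : V E) where

    open StarIn s (λ δ → component δ (enum k)) public
    open Hom R (proj₁ (enum k)) (λ _ t → t) public

    ξ : StrictHom digraph R
    ξ = hom , hom-strict-at (enum-in k) (λ _ t → t) (λ _ t∈ → t∈)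

    α-ξ-centre : α R digraph hom (enc centre) ≡ enum k
    α-ξ-centre = α-centre refl (λ _ t∈ → t∈) (λ _ t∈ → _ , t∈ , refl)

  α-φ : ∀ k → α R E φ k ≡ enum k
  α-φ k = α-≡-triple R E φ k refl λ δ t → mk⇔ (sound δ) (complete δ)
    where
    open Realiser k
    sound : ∀ δ {t} → Image δ E φ k t → t ∈ component δ (enum k)
    sound δ (l , nb , φl≡t) = subst (_∈ component δ (enum k)) φl≡t (Nbr⇒∈component δ nb)
    complete : ∀ δ {t} → t ∈ component δ (enum k) → Image δ E φ k t
    complete δ {t} t∈ =
      l , Nbr-realised δ digraph ∈D' ξ (from (Nbr-enc δ) (spoke δ t∈)) (sym α-ξ-centre) l≡ , φl≡t
      where
      l : V E
      l = index digraph ξ (enc (leaf δ t))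
      l≡ : enum l ≡ α R digraph hom (enc (leaf δ t))
      l≡ = enum-index digraph ξ (enc (leaf δ t))
      φl≡t : φ l ≡ t
      φl≡t = trans (cong proj₁ l≡) (hom-leaf {δ} t∈)

module Injectivity {D' : Digraph → Set} {R S : Digraph} (s : Setting D' R)
  (ρ : SScheme D' R S) (compatible : Compatible D' R S ρ) (𝓔 : EVSystem D' R)
  (E∈ : D' (EVSystem.E 𝓔)) (φ-strict : IsStrictHom (EVSystem.E 𝓔) R (EVSystem.φ 𝓔))
  (strong : Strong D' R S ρ) where

  open EVSystem 𝓔
  open EV s 𝓔

  ψ : V E → V S
  ψ = proj₁ (ρ E E∈ (φ , φ-strict))

  ρ-value-≡ : ∀ G G′ (G∈ : D' G) (G′∈ : D' G′) ξ ζ {v w} →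
    α R G (proj₁ ξ) v ≡ α R G′ (proj₁ ζ) w → proj₁ (ρ G G∈ ξ) v ≡ proj₁ (ρ G′ G′∈ ζ) w
  ρ-value-≡ G G′ G∈ G′∈ ξ ζ e = cong proj₁ (compatible G G′ G∈ G′∈ ξ ζ _ _ e)

  module ρRealiser (k : V E) where

    open Realiser k public

    ρξ : V digraph → V S
    ρξ = proj₁ (ρ digraph ∈D' ξ)

    α-ρξ-centre : α S digraph ρξ (enc centre) ≡ α S E ψ k
    α-ρξ-centre =
      compatible digraph E ∈D' E∈ ξ (φ , φ-strict) (enc centre) k (trans α-ξ-centre (sym (α-φ k)))

  module PairStar (i j : V E) (ψ-eq : α S E ψ i ≡ α S E ψ j) where

    module A = ρRealiser i
    module B = ρRealiser j
    module AB = TwoStars (loopsOf s) (transitiveOf s)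
                  (λ δ → component δ (enum i)) (λ δ → component δ (enum j))
    module BA = TwoStars (loopsOf s) (transitiveOf s)
                  (λ δ → component δ (enum j)) (λ δ → component δ (enum i))

    centres : α S A.digraph A.ρξ (A.enc centre) ≡ α S B.digraph B.ρξ (B.enc centre)
    centres = trans A.α-ρξ-centre (trans ψ-eq (sym B.α-ρξ-centre))

    Matched : Dir → V R → V R → Set
    Matched δ p q = p ∈ component δ (enum i) × q ∈ component δ (enum j)
                  × A.ρξ (A.enc (leaf δ p)) ≡ B.ρξ (B.enc (leaf δ q))

    match-right : ∀ {δ p} → p ∈ component δ (enum i) → ∃[ q ] Matched δ p q
    match-right p∈ = let (q , q∈ , e) = AB.leaf-match S A.ρξ B.ρξ centres p∈ in q , p∈ , q∈ , sym e

    match-left : ∀ {δ q} → q ∈ component δ (enum j) → ∃[ p ] Matched δ p q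
    match-left q∈ = let (p , p∈ , e) = BA.leaf-match S B.ρξ A.ρξ (sym centres) q∈ in p , p∈ , q∈ , e

    order : ℕ
    order = suc (size R)

    first second : Fin (order * order) → V R
    first  = proj₁ ∘ remQuot {order} order
    second = proj₂ ∘ remQuot {order} order

    pair : V R → V R → Fin (order * order)
    pair = combine {order} {order}

    remQuot-pair : ∀ p q → remQuot {order} order (pair p q) ≡ (p , q)
    remQuot-pair = remQuot-combine {order} {order}

    matches : Dir → Fin (order * order) → Bool
    matches δ a = lookup (component δ (enum i)) (first a)
                ∧ (lookup (component δ (enum j)) (second a)
                ∧ ⌊ A.ρξ (A.enc (leaf δ (first a))) ≟ B.ρξ (B.enc (leaf δ (second a))) ⌋)

    matched : Dir → Subset (order * order)
    matched δ = tabulate (matches δ)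

    ∈-matched : ∀ {δ a} → a ∈ matched δ ⇔ Matched δ (first a) (second a)
    ∈-matched {δ} = mk⇔
      (λ a∈ → let (p∈ , rest) = to T-∧ (to (∈-tabulate (matches δ)) a∈) ; (q∈ , e) = to T-∧ rest
              in from ∈⇔T-lookup p∈ , from ∈⇔T-lookup q∈ , toWitness e)
      (λ (p∈ , q∈ , e) → from (∈-tabulate (matches δ))
        (from T-∧ (to ∈⇔T-lookup p∈ , from T-∧ (to ∈⇔T-lookup q∈ , fromWitness e))))

    pair-∈-matched : ∀ {δ p q} → Matched δ p q → pair p q ∈ matched δ
    pair-∈-matched {δ} {p} {q} m =
      from ∈-matched (subst (λ (x , y) → Matched δ x y) (sym (remQuot-pair p q)) m)

    first∈ : ∀ δ {a} → a ∈ matched δ → first a ∈ component δ (enum i)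
    first∈ δ = proj₁ ∘ to (∈-matched {δ})

    second∈ : ∀ δ {a} → a ∈ matched δ → second a ∈ component δ (enum j)
    second∈ δ = proj₁ ∘ proj₂ ∘ to (∈-matched {δ})

    module P = StarIn s matched
    module X = P.Hom R (proj₁ (enum i)) (λ _ → first)
    module Z = P.Hom R (proj₁ (enum j)) (λ _ → second)
    module XA = TwoStars (loopsOf s) (transitiveOf s) matched (λ δ → component δ (enum i))
    module BZ = TwoStars (loopsOf s) (transitiveOf s) (λ δ → component δ (enum j)) matched

    ξ₂ ζ₂ : StrictHom P.digraph R
    ξ₂ = X.hom , P.hom-strict-at (enum-in i) (λ _ → first) first∈
    ζ₂ = Z.hom , P.hom-strict-at (enum-in j) (λ _ → second) second∈

    α-ξ₂-centre : α R P.digraph X.hom (P.enc centre) ≡ enum i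
    α-ξ₂-centre = X.α-centre refl first∈ λ δ {p} p∈ →
      let (q , m) = match-right {δ} p∈ in pair p q , pair-∈-matched m , cong proj₁ (remQuot-pair p q)

    α-ζ₂-centre : α R P.digraph Z.hom (P.enc centre) ≡ enum j
    α-ζ₂-centre = Z.α-centre refl second∈ λ δ {q} q∈ →
      let (p , m) = match-left {δ} q∈ in pair p q , pair-∈-matched m , cong proj₂ (remQuot-pair p q)

    ρξ₂ ρζ₂ : V P.digraph → V S
    ρξ₂ = proj₁ (ρ P.digraph P.∈D' ξ₂)
    ρζ₂ = proj₁ (ρ P.digraph P.∈D' ζ₂)

    matched-leaf : ∀ {δ a} → a ∈ matched δ → ρξ₂ (P.enc (leaf δ a)) ≡ ρζ₂ (P.enc (leaf δ a))
    matched-leaf {δ} {a} a∈ = begin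
      ρξ₂ (P.enc (leaf δ a))           ≡⟨ ρ-value-≡ P.digraph A.digraph P.∈D' A.∈D' ξ₂ A.ξ α-leaf-XA ⟩
      A.ρξ (A.enc (leaf δ (first a)))  ≡⟨ proj₂ (proj₂ (to (∈-matched {δ}) a∈)) ⟩
      B.ρξ (B.enc (leaf δ (second a))) ≡⟨ ρ-value-≡ B.digraph P.digraph B.∈D' P.∈D' B.ξ ζ₂ α-leaf-BZ ⟩
      ρζ₂ (P.enc (leaf δ a))           ∎
      where
      open ≡-Reasoning
      p∈ : first a ∈ component δ (enum i)
      p∈ = first∈ δ a∈
      q∈ : second a ∈ component δ (enum j)
      q∈ = second∈ δ a∈
      α-leaf-XA : α R P.digraph X.hom (P.enc (leaf δ a)) ≡ α R A.digraph A.hom (A.enc (leaf δ (first a)))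
      α-leaf-XA = XA.leaf-α-≡ R X.hom A.hom (trans α-ξ₂-centre (sym A.α-ξ-centre)) {δ} a∈ p∈
                    (trans (X.hom-leaf {δ} a∈) (sym (A.hom-leaf {δ} p∈)))
      α-leaf-BZ : α R B.digraph B.hom (B.enc (leaf δ (second a))) ≡ α R P.digraph Z.hom (P.enc (leaf δ a))
      α-leaf-BZ = BZ.leaf-α-≡ R B.hom Z.hom (trans B.α-ξ-centre (sym α-ζ₂-centre)) {δ} q∈ a∈
                    (trans (B.hom-leaf {δ} q∈) (sym (Z.hom-leaf {δ} a∈)))

    unmatched-leaf : ∀ {δ a} → a ∉ matched δ → ρξ₂ (P.enc (leaf δ a)) ≡ ρζ₂ (P.enc (leaf δ a))
    unmatched-leaf {δ} {a} a∉ = ρ-value-≡ P.digraph P.digraph P.∈D' P.∈D' ξ₂ ζ₂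
      (α-isolated-≡ R P.digraph X.hom Z.hom (P.enc (leaf δ a)) (P.unused-isolated {δ} {a} a∉)
        (trans (X.hom-unused {δ} {a} a∉) (sym (Z.hom-unused {δ} {a} a∉))))

    ρξ₂≡ρζ₂ : ∀ k → ρξ₂ (P.enc k) ≡ ρζ₂ (P.enc k)
    ρξ₂≡ρζ₂ centre = begin
      ρξ₂ (P.enc centre)  ≡⟨ ρ-value-≡ _ _ P.∈D' A.∈D' ξ₂ A.ξ (trans α-ξ₂-centre (sym A.α-ξ-centre)) ⟩
      A.ρξ (A.enc centre) ≡⟨ cong proj₁ centres ⟩
      B.ρξ (B.enc centre) ≡⟨ ρ-value-≡ _ _ B.∈D' P.∈D' B.ξ ζ₂ (trans B.α-ξ-centre (sym α-ζ₂-centre)) ⟩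
      ρζ₂ (P.enc centre)  ∎
      where open ≡-Reasoning
    ρξ₂≡ρζ₂ (leaf δ a) = by-membership (a ∈? matched δ)
      where
      by-membership : Dec (a ∈ matched δ) → ρξ₂ (P.enc (leaf δ a)) ≡ ρζ₂ (P.enc (leaf δ a))
      by-membership (yes a∈) = matched-leaf {δ} {a} a∈
      by-membership (no a∉)  = unmatched-leaf {δ} {a} a∉

    ξ₂≡ζ₂ : ∀ v → X.hom v ≡ Z.hom v
    ξ₂≡ζ₂ = strong P.digraph P.∈D' ξ₂ ζ₂ λ v →
      subst (λ u → ρξ₂ u ≡ ρζ₂ u) (P.enc-dec v) (ρξ₂≡ρζ₂ (P.dec v))

    centre-≡ : proj₁ (enum i) ≡ proj₁ (enum j)
    centre-≡ = trans (sym (X.hom-enc centre)) (trans (ξ₂≡ζ₂ (P.enc centre)) (Z.hom-enc centre))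

    matched-diagonal : ∀ {δ p q} → Matched δ p q → p ≡ q
    matched-diagonal {δ} {p} {q} m = begin
      p                                 ≡⟨ sym (cong proj₁ (remQuot-pair p q)) ⟩
      first (pair p q)                  ≡⟨ sym (X.hom-leaf {δ} pq∈) ⟩
      X.hom (P.enc (leaf δ (pair p q))) ≡⟨ ξ₂≡ζ₂ (P.enc (leaf δ (pair p q))) ⟩
      Z.hom (P.enc (leaf δ (pair p q))) ≡⟨ Z.hom-leaf {δ} pq∈ ⟩
      second (pair p q)                 ≡⟨ cong proj₂ (remQuot-pair p q) ⟩
      q                                 ∎
      where
      open ≡-Reasoning
      pq∈ : pair p q ∈ matched δ
      pq∈ = pair-∈-matched m

    component-⊆ : ∀ δ → component δ (enum i) ⊆ component δ (enum j)
    component-⊆ δ p∈ = let (q , m) = match-right {δ} p∈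
                       in subst (_∈ component δ (enum j)) (sym (matched-diagonal m)) (proj₁ (proj₂ m))

    component-⊇ : ∀ δ → component δ (enum j) ⊆ component δ (enum i)
    component-⊇ δ q∈ = let (p , m) = match-left {δ} q∈
                       in subst (_∈ component δ (enum i)) (matched-diagonal m) (proj₁ m)

lemma5 : (D' : Digraph → Set) (R S : Digraph) → Setting D' R →
    (ρ : SScheme D' R S) → Compatible D' R S ρ →
    (𝓔 : EVSystem D' R) →
    (E∈ : D' (EVSystem.E 𝓔)) →
    (φ-strict : IsStrictHom (EVSystem.E 𝓔) R (EVSystem.φ 𝓔)) →
    Strong D' R S ρ →
    ∀ i j →
    α S (EVSystem.E 𝓔) (proj₁ (ρ (EVSystem.E 𝓔) E∈ (EVSystem.φ 𝓔 , φ-strict))) i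
      ≡ α S (EVSystem.E 𝓔) (proj₁ (ρ (EVSystem.E 𝓔) E∈ (EVSystem.φ 𝓔 , φ-strict))) j →
    EVSystem.enum 𝓔 i ≡ EVSystem.enum 𝓔 j
lemma5 D' R S s ρ compatible 𝓔 E∈ φ-strict strong i j ε-eq =
  triple-≡ centre-≡ λ δ → ⊆-antisym (component-⊆ δ) (component-⊇ δ)
  where
  open Injectivity {D'} {R} {S} s ρ compatible 𝓔 E∈ φ-strict strong
  open PairStar i j ε-eq
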